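{- Let $(\mathcal{P},\mathcal{L})$ be an antipodal plane of order $s\geq 3$ embedded in $\mathrm{PG}(2,q)$. Then there exist three points $A_1,A_2,A_3\in\mathcal{P}$, not collinear in $\mathrm{PG}(2,q)$, such that the three lines $A_1A_2$, $A_1A_3$, $A_2A_3$ are (images of) lines of $\mathcal{L}$, and such that none of the antipodal points $A_1^\perp,A_2^\perp,A_3^\perp$ lies on any of these three lines.
   Context: An antipodal plane of order $s\geq2$ is a partial linear space $(\mathcal{P},\mathcal{L})$ with $|\mathcal{P}|=|\mathcal{L}|=s^2+s+2$, every line containing $s+1$ points and every point on $s+1$ lines; for each point $P$, $P^\perp$ denotes the unique point not on a common line of $\mathcal{L}$ with $P$. An embedding in a projective plane is a pair of injective maps on points and lines preserving incidence and non-incidence; points and lines of $(\mathcal{P},\mathcal{L})$ are identified with their images in $\mathrm{PG}(2,q)$. -}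

module Defs where

open import Level using (Level; _⊔_) renaming (suc to lsuc)
open import Data.Nat using (ℕ; zero; suc)
import Data.Nat as N
open import Data.Fin using (Fin)
open import Data.Bool using (Bool; true; false; if_then_else_)
open import Data.List using (List; length; filter)
open import Data.List.Base using (allFin)
open import Data.Product using (Σ; ∃; _×_; _,_)
open import Relation.Nullary using (¬_)
open import Relation.Binary.PropositionalEquality using (_≡_; _≢_)
open import Algebra.Bundles using (CommutativeRing)

record Field (c ℓ : Level) : Set (lsuc (c ⊔ ℓ)) where
  field
    commRing : CommutativeRing c ℓ
  open CommutativeRing commRing public
  field
    0≉1      : ¬ (0# ≈ 1#)
    inverse  : ∀ x → ¬ (x ≈ 0#) → ∃ λ y → (x * y) ≈ 1#

record FiniteField (c ℓ : Level) (q : ℕ) : Set (lsuc (c ⊔ ℓ)) where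
  field
    F        : Field c ℓ
  open Field F public
  field
    enum     : Fin q → Carrier
    enum-inj : ∀ i j → enum i ≈ enum j → i ≡ j
    enum-sur : ∀ x → ∃ λ i → enum i ≈ x

-- Points and lines are nonzero vectors of F³ (homogeneous coordinates);
-- two vectors represent the same point/line iff they are proportional;
-- incidence is vanishing of the standard bilinear form.

module PG {c ℓ : Level} {q : ℕ} (K : FiniteField c ℓ q) where
  open FiniteField K

  record Vec3 : Set c where
    constructor ⟨_,_,_⟩
    field x₀ x₁ x₂ : Carrier

  open Vec3

  IsZero : Vec3 → Set ℓ
  IsZero v = (x₀ v ≈ 0#) × (x₁ v ≈ 0#) × (x₂ v ≈ 0#)

  Point : Set (c ⊔ ℓ)
  Point = Σ Vec3 λ v → ¬ IsZero v

  Line : Set (c ⊔ ℓ)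
  Line = Point

  vec : Point → Vec3
  vec (v , _) = v

  _∼_ : Point → Point → Set (c ⊔ ℓ)
  P ∼ Q = ∃ λ λ' → ¬ (λ' ≈ 0#) ×
            ((x₀ (vec P) ≈ (λ' * x₀ (vec Q))) ×
             (x₁ (vec P) ≈ (λ' * x₁ (vec Q))) ×
             (x₂ (vec P) ≈ (λ' * x₂ (vec Q))))

  Inc : Point → Line → Set ℓ
  Inc P L = ((x₀ (vec P) * x₀ (vec L)) + (x₁ (vec P) * x₁ (vec L))
              + (x₂ (vec P) * x₂ (vec L))) ≈ 0#

  Collinear : Point → Point → Point → Set (c ⊔ ℓ)
  Collinear A B C = ∃ λ L → Inc A L × Inc B L × Inc C L

countF : ∀ {n} → (Fin n → Bool) → ℕ
countF {n} p = length (filter (λ i → p i Data.Bool.≟ true) (allFin n))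
  where import Data.Bool

nAP : ℕ → ℕ
nAP s = (s N.* s) N.+ s N.+ 2

record AntipodalPlane (s : ℕ) : Set where
  field
    I : Fin (nAP s) → Fin (nAP s) → Bool   -- I P ℓ ≡ true : point P on line ℓ
    line-size  : ∀ l → countF (λ P → I P l) ≡ suc s
    point-deg  : ∀ P → countF (λ l → I P l) ≡ suc s
    partial    : ∀ P Q l m → P ≢ Q → I P l ≡ true → I Q l ≡ true →
                   I P m ≡ true → I Q m ≡ true → l ≡ m

  Collinear : Fin (nAP s) → Fin (nAP s) → Set
  Collinear P Q = ∃ λ l → (I P l ≡ true) × (I Q l ≡ true)

  -- Q is the antipodal point P^⊥ of P: Q is not on a common line with P
  -- (in an antipodal plane there is exactly one such Q for each P).
  IsPerp : Fin (nAP s) → Fin (nAP s) → Set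
  IsPerp P Q = ¬ Collinear P Q

record Embedding {c ℓ : Level} {q s : ℕ} (K : FiniteField c ℓ q)
                 (A : AntipodalPlane s) : Set (c ⊔ ℓ) where
  open PG K
  open AntipodalPlane A
  field
    φ     : Fin (nAP s) → Point
    ψ     : Fin (nAP s) → Line
    φ-inj : ∀ P Q → φ P ∼ φ Q → P ≡ Q
    ψ-inj : ∀ l m → ψ l ∼ ψ m → l ≡ m
    inc   : ∀ P l → I P l ≡ true → Inc (φ P) (ψ l)
    noninc : ∀ P l → I P l ≡ false → ¬ Inc (φ P) (ψ l)

{-# OPTIONS --safe #-}
-- Take A₁ ≠ A₂ on a line l₁₂, the line n through A₂ and A₁^⊥ and the line m through A₁ and
-- A₂^⊥. A point X off l₁₂ other than A₁^⊥ and A₂^⊥ spans with A₁ and A₂ a triangle whose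
-- sides l₁₂, A₁X, A₂X are lines of the plane; it is a triangle of PG(2,q) because X is off
-- l₁₂, and as an antipode misses every line through its own point, it is the required one
-- unless A₁^⊥ ∈ A₂X (then A₂X = n), A₂^⊥ ∈ A₁X (then A₁X = m) or X^⊥ ∈ l₁₂ ∖ {A₁, A₂}.
-- If that always happens, all s² + s + 2 points lie on n or m, in l₁₂ ∖ {A₁, A₂}, or are
-- antipodes of points of l₁₂ ∖ {A₁, A₂}: at most 4s points, too few when s ≥ 3.
module Submission where

open import Defs
open import Level using (Level; _⊔_)
open import Data.Nat as Nat using (ℕ; zero; suc; _≤_; _<_; _≥_; z≤n; s≤s; z<s)
open import Data.Nat.Properties
  using (≤-trans; +-comm; suc-injective; <⇒≱; ≤-reflexive; +-monoˡ-≤; +-mono-≤; *-monoˡ-≤; m<m+n;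
         module ≤-Reasoning)
open import Data.Nat.Tactic.RingSolver using (solve-∀)
open import Data.Bool using (true; false)
open import Data.Bool.Properties using (¬-not) renaming (_≟_ to _≟ᵇ_)
import Data.Fin as Fin
open Fin using (Fin)
open import Data.Fin.Properties using (∀-cons; any?) renaming (_≟_ to _≟ᶠ_)
open import Data.List using (List; []; _∷_; length; filter; allFin; concatMap; map; _++_)
open import Data.List.Properties
  using (filter-notAll; filter-all; filter-accept; filter-reject;
         length-++; length-map; length-tabulate)
open import Data.List.Membership.Propositional using (_∈_; _∉_; find; lose)
open import Data.List.Membership.Propositional.Properties
  using (∈-filter⁺; ∈-filter⁻; ∈-allFin; ∈-concatMap⁺; ∈-concatMap⁻; ∈-++⁺ˡ; ∈-++⁺ʳ; ∈-map⁺)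
open import Data.List.Relation.Unary.Any as Any using (here; there)
open import Data.List.Relation.Unary.All as All using (All; []; _∷_)
open import Data.List.Relation.Unary.All.Properties using (¬Any⇒All¬)
open import Data.List.Relation.Unary.AllPairs using ([]; _∷_)
open import Data.List.Relation.Unary.Unique.Propositional using (Unique)
import Data.List.Relation.Unary.Unique.Propositional.Properties as Unique
open import Data.Product using (∃; _×_; _,_; proj₁; proj₂)
open import Data.Sum using (_⊎_; inj₁; inj₂; [_,_]′)
open import Data.Empty using (⊥-elim)
open import Data.Vec.N-ary using (N-ary)
open import Function using (_∘_; id)
open import Relation.Nullary using (¬_; ¬?; Dec; yes; no)
open import Relation.Nullary.Decidable using (_×-dec_; decidable-stable)
open import Relation.Binary.Definitions using (DecidableEquality)
open import Relation.Binary.PropositionalEquality as ≡ using (_≡_; _≢_)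

¬¬-×₃ : ∀ {a b c} {A : Set a} {B : Set b} {C : Set c} →
        ¬ ¬ A → ¬ ¬ B → ¬ ¬ C → ¬ ¬ (A × B × C)
¬¬-×₃ ¬¬a ¬¬b ¬¬c ¬abc = ¬¬a λ a → ¬¬b λ b → ¬¬c λ c → ¬abc (a , b , c)

module FieldProperties {c ℓ : Level} (F : Field c ℓ) where
  open Field F
  open import Relation.Binary.Reasoning.Setoid setoid
  open import Algebra.Properties.CommutativeSemigroup *-commutativeSemigroup
    using (xy∙z≈xz∙y)

  *-cancelˡ : ∀ {a x y} → ¬ a ≈ 0# → a * x ≈ a * y → x ≈ y
  *-cancelˡ {a} {x} {y} a≉0 ax≈ay with inverse a a≉0
  ... | a⁻¹ , aa⁻¹≈1 = begin
    x              ≈⟨ undo x ⟨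
    a⁻¹ * (a * x)  ≈⟨ *-congˡ ax≈ay ⟩
    a⁻¹ * (a * y)  ≈⟨ undo y ⟩
    y              ∎
    where
    undo : ∀ z → a⁻¹ * (a * z) ≈ z
    undo z = begin
      a⁻¹ * (a * z) ≈⟨ *-assoc a⁻¹ a z ⟨
      (a⁻¹ * a) * z ≈⟨ *-congʳ (trans (*-comm a⁻¹ a) aa⁻¹≈1) ⟩
      1# * z        ≈⟨ *-identityˡ z ⟩
      z             ∎

  *-cancelʳ : ∀ {a x y} → ¬ a ≈ 0# → x * a ≈ y * a → x ≈ y
  *-cancelʳ {a} {x} {y} a≉0 xa≈ya = *-cancelˡ a≉0 (trans (*-comm a x) (trans xa≈ya (*-comm y a)))

  ≈0⇒*≈0 : ∀ {a} x → a ≈ 0# → a * x ≈ 0#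
  ≈0⇒*≈0 x a≈0 = trans (*-congʳ a≈0) (zeroˡ x)

  ≈0⇒+-identityʳ : ∀ {a} x → a ≈ 0# → x + a ≈ x
  ≈0⇒+-identityʳ x a≈0 = trans (+-congˡ a≈0) (+-identityʳ x)

  proportional : ∀ {a₀ a₁ a₂ b₀ b₁ b₂} → ¬ b₀ ≈ 0# →
                 a₀ * b₁ ≈ a₁ * b₀ → a₀ * b₂ ≈ a₂ * b₀ →
                 ∃ λ t → a₀ ≈ t * b₀ × a₁ ≈ t * b₁ × a₂ ≈ t * b₂
  proportional {a₀} {b₀ = b₀} b₀≉0 e₁ e₂ with inverse b₀ b₀≉0
  ... | y , b₀y≈1 = a₀ * y , scaled refl , scaled e₁ , scaled e₂
    where
    scaled : ∀ {a b} → a₀ * b ≈ a * b₀ → a ≈ (a₀ * y) * b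
    scaled {a} {b} e = begin
      a              ≈⟨ *-identityʳ a ⟨
      a * 1#         ≈⟨ *-congˡ b₀y≈1 ⟨
      a * (b₀ * y)   ≈⟨ *-assoc a b₀ y ⟨
      (a * b₀) * y   ≈⟨ *-congʳ e ⟨
      (a₀ * b) * y   ≈⟨ xy∙z≈xz∙y a₀ b y ⟩
      (a₀ * y) * b   ∎

module Coordinates {c ℓ : Level} {q : ℕ} (K : FiniteField c ℓ q) where
  open FiniteField K
  open PG K
  open Vec3
  open FieldProperties F
  open import Relation.Binary.Reasoning.Setoid setoid
  open import Algebra.Properties.Group +-group using (∙-cancelˡ)
  open import Algebra.Solver.Ring.NaturalCoefficients.Default commutativeSemiring
    using (Polynomial; solve; _:=_; _:+_; _:*_)

  infix  4 _≈₃_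
  infixl 6 _+₃_
  infix  4 _∥_
  infixl 7 _·_ _⨯⁺_ _⨯⁻_ _*₃_

  _≈₃_ : Vec3 → Vec3 → Set ℓ
  u ≈₃ v = x₀ u ≈ x₀ v × x₁ u ≈ x₁ v × x₂ u ≈ x₂ v

  _·_ : Vec3 → Vec3 → Carrier
  u · v = x₀ u * x₀ v + x₁ u * x₁ v + x₂ u * x₂ v

  _*₃_ : Carrier → Vec3 → Vec3
  a *₃ v = ⟨ a * x₀ v , a * x₁ v , a * x₂ v ⟩

  _+₃_ : Vec3 → Vec3 → Vec3
  u +₃ v = ⟨ x₀ u + x₀ v , x₁ u + x₁ v , x₂ u + x₂ v ⟩

  -- The cross product is u ⨯⁺ v - u ⨯⁻ v and the determinant det⁺ - det⁻; keeping the
  -- two halves apart makes Cramer's rule an identity of commutative semirings.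
  _⨯⁺_ _⨯⁻_ : Vec3 → Vec3 → Vec3
  u ⨯⁺ v = ⟨ x₁ u * x₂ v , x₂ u * x₀ v , x₀ u * x₁ v ⟩
  u ⨯⁻ v = ⟨ x₂ u * x₁ v , x₀ u * x₂ v , x₁ u * x₀ v ⟩

  det⁺ det⁻ : Vec3 → Vec3 → Vec3 → Carrier
  det⁺ u v w = u ⨯⁺ v · w
  det⁻ u v w = u ⨯⁻ v · w

  Singular : Vec3 → Vec3 → Vec3 → Set ℓ
  Singular u v w = det⁺ u v w ≈ det⁻ u v w

  _∥_ : Vec3 → Vec3 → Set ℓ
  u ∥ v = u ⨯⁺ v ≈₃ u ⨯⁻ v

  -- Q ⨯ R, R ⨯ P, P ⨯ Q are the columns of the adjugate of the matrix with rows P, Q, R.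
  cramer : ∀ P Q R N →
    det⁺ P Q R *₃ N +₃ ((P · N) *₃ (Q ⨯⁻ R) +₃ (Q · N) *₃ (R ⨯⁻ P) +₃ (R · N) *₃ (P ⨯⁻ Q)) ≈₃
    det⁻ P Q R *₃ N +₃ ((P · N) *₃ (Q ⨯⁺ R) +₃ (Q · N) *₃ (R ⨯⁺ P) +₃ (R · N) *₃ (P ⨯⁺ Q))
  cramer ⟨ p₀ , p₁ , p₂ ⟩ ⟨ q₀ , q₁ , q₂ ⟩ ⟨ r₀ , r₁ , r₂ ⟩ ⟨ n₀ , n₁ , n₂ ⟩ =
    solve 12 (equation proj₁) refl p₀ p₁ p₂ q₀ q₁ q₂ r₀ r₁ r₂ n₀ n₁ n₂ ,
    solve 12 (equation (proj₁ ∘ proj₂)) refl p₀ p₁ p₂ q₀ q₁ q₂ r₀ r₁ r₂ n₀ n₁ n₂ ,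
    solve 12 (equation (proj₂ ∘ proj₂)) refl p₀ p₁ p₂ q₀ q₁ q₂ r₀ r₁ r₂ n₀ n₁ n₂
    where
    Poly³ : Set
    Poly³ = Polynomial 12 × Polynomial 12 × Polynomial 12

    dot : Poly³ → Poly³ → Polynomial 12
    dot (u₀ , u₁ , u₂) (v₀ , v₁ , v₂) = u₀ :* v₀ :+ u₁ :* v₁ :+ u₂ :* v₂

    cross⁺ cross⁻ : Poly³ → Poly³ → Poly³
    cross⁺ (u₀ , u₁ , u₂) (v₀ , v₁ , v₂) = u₁ :* v₂ , u₂ :* v₀ , u₀ :* v₁
    cross⁻ (u₀ , u₁ , u₂) (v₀ , v₁ , v₂) = u₂ :* v₁ , u₀ :* v₂ , u₁ :* v₀

    equation : (Poly³ → Polynomial 12) → N-ary 12 (Polynomial 12) (Polynomial 12 × Polynomial 12)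
    equation π p₀ p₁ p₂ q₀ q₁ q₂ r₀ r₁ r₂ n₀ n₁ n₂ =
      dot (cross⁺ P Q) R :* π N :+
        (dot P N :* π (cross⁻ Q R) :+ dot Q N :* π (cross⁻ R P) :+ dot R N :* π (cross⁻ P Q))
      := dot (cross⁻ P Q) R :* π N :+
        (dot P N :* π (cross⁺ Q R) :+ dot Q N :* π (cross⁺ R P) :+ dot R N :* π (cross⁺ P Q))
      where
      P Q R N : Poly³
      P = p₀ , p₁ , p₂
      Q = q₀ , q₁ , q₂
      R = r₀ , r₁ , r₂
      N = n₀ , n₁ , n₂

  cramer-⊥ : ∀ {P Q N} R → P · N ≈ 0# → Q · N ≈ 0# →
    det⁺ P Q R *₃ N +₃ (R · N) *₃ (P ⨯⁻ Q) ≈₃ det⁻ P Q R *₃ N +₃ (R · N) *₃ (P ⨯⁺ Q)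
  cramer-⊥ {P} {Q} {N} R P·N≈0 Q·N≈0 =
    let e₀ , e₁ , e₂ = cramer P Q R N in drop e₀ , drop e₁ , drop e₂
    where
    vanish : ∀ x u v w → x + (P · N * u + Q · N * v + w) ≈ x + w
    vanish x u v w = +-congˡ (begin
      P · N * u + Q · N * v + w ≈⟨ +-congʳ (+-congʳ (≈0⇒*≈0 u P·N≈0)) ⟩
      0# + Q · N * v + w        ≈⟨ +-congʳ (+-identityˡ _) ⟩
      Q · N * v + w             ≈⟨ +-congʳ (≈0⇒*≈0 v Q·N≈0) ⟩
      0# + w                    ≈⟨ +-identityˡ w ⟩
      w                         ∎)
    drop : ∀ {x u v w x′ u′ v′ w′} →
           x + (P · N * u + Q · N * v + w) ≈ x′ + (P · N * u′ + Q · N * v′ + w′) → x + w ≈ x′ + w′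
    drop e = trans (sym (vanish _ _ _ _)) (trans e (vanish _ _ _ _))

  common-line⇒¬¬singular : ∀ {P Q R L} → ¬ IsZero L → P · L ≈ 0# → Q · L ≈ 0# → R · L ≈ 0# →
                            ¬ ¬ Singular P Q R
  common-line⇒¬¬singular {P} {Q} {R} {L} L≉0 P·L≈0 Q·L≈0 R·L≈0 d⁺≉d⁻ =
    let e₀ , e₁ , e₂ = cramer-⊥ R P·L≈0 Q·L≈0 in
    ¬¬-×₃ (coordinate e₀) (coordinate e₁) (coordinate e₂) L≉0
    where
    coordinate : ∀ {l w w′} → det⁺ P Q R * l + R · L * w ≈ det⁻ P Q R * l + R · L * w′ → ¬ ¬ l ≈ 0#
    coordinate {l} {w} {w′} e l≉0 = d⁺≉d⁻ (*-cancelʳ l≉0 (begin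
      det⁺ P Q R * l                ≈⟨ ≈0⇒+-identityʳ _ (≈0⇒*≈0 w R·L≈0) ⟨
      det⁺ P Q R * l + R · L * w    ≈⟨ e ⟩
      det⁻ P Q R * l + R · L * w′   ≈⟨ ≈0⇒+-identityʳ _ (≈0⇒*≈0 w′ R·L≈0) ⟩
      det⁻ P Q R * l                ∎))

  singular⇒∥ : ∀ {P Q R M} → ¬ R · M ≈ 0# → P · M ≈ 0# → Q · M ≈ 0# → Singular P Q R → P ∥ Q
  singular⇒∥ {P} {Q} {R} {M} R·M≉0 P·M≈0 Q·M≈0 d⁺≈d⁻ =
    let e₀ , e₁ , e₂ = cramer-⊥ R P·M≈0 Q·M≈0 in
    coordinate e₀ , coordinate e₁ , coordinate e₂
    where
    coordinate : ∀ {m w⁺ w⁻} → det⁺ P Q R * m + R · M * w⁻ ≈ det⁻ P Q R * m + R · M * w⁺ → w⁺ ≈ w⁻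
    coordinate {m} {w⁺} {w⁻} e = sym (*-cancelˡ R·M≉0 (∙-cancelˡ (det⁺ P Q R * m) _ _
      (trans e (+-congʳ (*-congʳ (sym d⁺≈d⁻))))))

  ∥⇒¬¬∼ : ∀ (P Q : Point) → vec P ∥ vec Q → ¬ ¬ P ∼ Q
  ∥⇒¬¬∼ P@(⟨ p₀ , p₁ , p₂ ⟩ , P≉0) Q@(⟨ q₀ , q₁ , q₂ ⟩ , Q≉0) (c₀ , c₁ , c₂) P≁Q =
    ¬¬-×₃ (λ q₀≉0 → let t , e₀ , e₁ , e₂ = proportional q₀≉0 c₂ (sym c₁)
                    in P≁Q (multiple t e₀ e₁ e₂))
          (λ q₁≉0 → let t , e₁ , e₂ , e₀ = proportional q₁≉0 c₀ (sym c₂)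
                    in P≁Q (multiple t e₀ e₁ e₂))
          (λ q₂≉0 → let t , e₂ , e₀ , e₁ = proportional q₂≉0 c₁ (sym c₀)
                    in P≁Q (multiple t e₀ e₁ e₂))
          Q≉0
    where
    multiple : ∀ t → p₀ ≈ t * q₀ → p₁ ≈ t * q₁ → p₂ ≈ t * q₂ → P ∼ Q
    multiple t e₀ e₁ e₂ = t , t≉0 , e₀ , e₁ , e₂
      where
      t≉0 : ¬ t ≈ 0#
      t≉0 t≈0 = P≉0 (trans e₀ (≈0⇒*≈0 q₀ t≈0) , trans e₁ (≈0⇒*≈0 q₁ t≈0) , trans e₂ (≈0⇒*≈0 q₂ t≈0))

  -- Equality of the field is not decidable here, so the intermediate facts are only available
  -- doubly negated; as the conclusion is itself a negation, that suffices.
  ¬Inc⇒¬Collinear : ∀ (P Q R M : Point) → ¬ P ∼ Q → Inc P M → Inc Q M → ¬ Inc R M →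
                    ¬ Collinear P Q R
  ¬Inc⇒¬Collinear P Q R M P≁Q P∈M Q∈M R∉M ((L , L≉0) , P∈L , Q∈L , R∈L) =
    common-line⇒¬¬singular L≉0 P∈L Q∈L R∈L λ singular →
      ∥⇒¬¬∼ P Q (singular⇒∥ R∉M P∈M Q∈M singular) P≁Q

-- Opened only now, since the field operations above share these names.
open Nat using (_+_; _*_)
open ≡ using (refl; sym; trans; cong; cong₂; subst; subst₂)

module Removal {a : Level} {A : Set a} (_≟_ : DecidableEquality A) where

  remove : A → List A → List A
  remove a = filter (λ x → ¬? (x ≟ a))

  ∈-remove⁺ : ∀ {a x xs} → x ∈ xs → x ≢ a → x ∈ remove a xs
  ∈-remove⁺ = ∈-filter⁺ _

  ∈-remove⁻ : ∀ {a x} xs → x ∈ remove a xs → x ∈ xs × x ≢ a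
  ∈-remove⁻ xs = ∈-filter⁻ _ {xs = xs}

  remove-unique : ∀ {a xs} → Unique xs → Unique (remove a xs)
  remove-unique = Unique.filter⁺ _

  length-remove-< : ∀ {a xs} → a ∈ xs → length (remove a xs) < length xs
  length-remove-< {xs = xs} a∈xs = filter-notAll _ xs (Any.map (λ x≡a x≢a → x≢a (sym x≡a)) a∈xs)

  length-remove : ∀ {a xs} → Unique xs → a ∈ xs → suc (length (remove a xs)) ≡ length xs
  length-remove {a} {x ∷ xs} (x∉xs ∷ xs!) (here refl)
    rewrite filter-reject (λ x → ¬? (x ≟ a)) {xs = xs} (λ a≢a → a≢a refl)
          | filter-all (λ x → ¬? (x ≟ a)) (All.map (λ x≢a x≡a → x≢a (sym x≡a)) x∉xs) = refl
  length-remove {a} {x ∷ xs} (x∉xs ∷ xs!) (there a∈xs)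
    rewrite filter-accept (λ x → ¬? (x ≟ a)) {xs = xs} (λ x≡a → All.lookup x∉xs a∈xs x≡a)
    = cong suc (length-remove xs! a∈xs)

  0<length⇒∃∈ : ∀ {xs : List A} → 0 < length xs → ∃ (_∈ xs)
  0<length⇒∃∈ {x ∷ _} _ = x , here refl

  Unique-⊆⇒length≤ : ∀ {xs ys} → Unique xs → (∀ {x} → x ∈ xs → x ∈ ys) → length xs ≤ length ys
  Unique-⊆⇒length≤ {[]} _ _ = z≤n
  Unique-⊆⇒length≤ {x ∷ xs} {ys} (x∉xs ∷ xs!) xs⊆ys =
    ≤-trans (s≤s (Unique-⊆⇒length≤ xs! xs⊆ys∖x)) (length-remove-< (xs⊆ys (here refl)))
    where
    xs⊆ys∖x : ∀ {y} → y ∈ xs → y ∈ remove x ys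
    xs⊆ys∖x y∈xs = ∈-remove⁺ (xs⊆ys (there y∈xs)) (λ y≡x → All.lookup x∉xs y∈xs (sym y≡x))

∀⊎⇒⊎∀ : ∀ {a p} {A : Set a} {n} {P : Fin n → Set p} → (∀ i → A ⊎ P i) → A ⊎ (∀ i → P i)
∀⊎⇒⊎∀ {n = zero} f = inj₂ λ ()
∀⊎⇒⊎∀ {n = suc n} f with f Fin.zero | ∀⊎⇒⊎∀ (f ∘ Fin.suc)
... | inj₁ a  | _      = inj₁ a
... | inj₂ _  | inj₁ a = inj₁ a
... | inj₂ p₀ | inj₂ p = inj₂ (∀-cons p₀ p)

nAP≡ : ∀ s → nAP s ≡ suc (suc (suc s * s))
nAP≡ s = trans (+-comm (s * s + s) 2) (cong (2 +_) (+-comm (s * s) s))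

r+[1+s+[1+s+r]]<nAP : ∀ {s r} → 3 ≤ s → suc r ≤ s → r + (suc s + (suc s + r)) < nAP s
r+[1+s+[1+s+r]]<nAP {s} {r} 3≤s r<s = begin-strict
  r + (suc s + (suc s + r))  ≡⟨ regroup r s ⟩
  (suc r + suc r) + (s + s)  ≤⟨ +-monoˡ-≤ (s + s) (+-mono-≤ r<s r<s) ⟩
  (s + s) + (s + s)          <⟨ m<m+n _ z<s ⟩
  (s + s) + (s + s) + 2      ≡⟨ quadruple s ⟩
  3 * s + s + 2              ≤⟨ +-monoˡ-≤ 2 (+-monoˡ-≤ s (*-monoˡ-≤ s 3≤s)) ⟩
  s * s + s + 2              ∎
  where
  open ≤-Reasoning
  regroup : ∀ r s → r + (suc s + (suc s + r)) ≡ (suc r + suc r) + (s + s)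
  regroup = solve-∀
  quadruple : ∀ s → (s + s) + (s + s) + 2 ≡ 3 * s + s + 2
  quadruple = solve-∀

module AntipodalPlaneProperties {s : ℕ} (𝒜 : AntipodalPlane s) where
  open AntipodalPlane 𝒜
  open Removal (_≟ᶠ_ {nAP s})

  pointsOn linesThrough : Fin (nAP s) → List (Fin (nAP s))
  pointsOn l = filter (λ P → I P l ≟ᵇ true) (allFin (nAP s))
  linesThrough P = filter (λ l → I P l ≟ᵇ true) (allFin (nAP s))

  ∈-pointsOn⁺ : ∀ {P l} → I P l ≡ true → P ∈ pointsOn l
  ∈-pointsOn⁺ {P} = ∈-filter⁺ _ (∈-allFin P)

  ∈-pointsOn⁻ : ∀ {P l} → P ∈ pointsOn l → I P l ≡ true
  ∈-pointsOn⁻ {l = l} = proj₂ ∘ ∈-filter⁻ (λ P → I P l ≟ᵇ true) {xs = allFin (nAP s)}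

  ∈-linesThrough⁺ : ∀ {P l} → I P l ≡ true → l ∈ linesThrough P
  ∈-linesThrough⁺ {l = l} = ∈-filter⁺ _ (∈-allFin l)

  ∈-linesThrough⁻ : ∀ {P l} → l ∈ linesThrough P → I P l ≡ true
  ∈-linesThrough⁻ {P} = proj₂ ∘ ∈-filter⁻ (λ l → I P l ≟ᵇ true) {xs = allFin (nAP s)}

  pointsOn-unique : ∀ l → Unique (pointsOn l)
  pointsOn-unique l = Unique.filter⁺ _ (Unique.allFin⁺ (nAP s))

  linesThrough-unique : ∀ P → Unique (linesThrough P)
  linesThrough-unique P = Unique.filter⁺ _ (Unique.allFin⁺ (nAP s))

  length-remove-pointsOn : ∀ {P l} → I P l ≡ true → length (remove P (pointsOn l)) ≡ s
  length-remove-pointsOn {P} {l} P∈l =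
    suc-injective (trans (length-remove (pointsOn-unique l) (∈-pointsOn⁺ P∈l)) (line-size l))

  collinear? : ∀ P Q → Dec (Collinear P Q)
  collinear? P Q = any? λ l → (I P l ≟ᵇ true) ×-dec (I Q l ≟ᵇ true)

  collinear-refl : ∀ P → Collinear P P
  collinear-refl P = let l , l∈ = 0<length⇒∃∈ (subst (0 <_) (sym (point-deg P)) z<s) in
    l , ∈-linesThrough⁻ l∈ , ∈-linesThrough⁻ l∈

  star : Fin (nAP s) → List (Fin (nAP s))
  star P = concatMap (remove P ∘ pointsOn) (linesThrough P)

  ∈-star⁺ : ∀ {P X} → Collinear P X → X ≢ P → X ∈ star P
  ∈-star⁺ (l , P∈l , X∈l) X≢P =
    ∈-concatMap⁺ (remove _ ∘ pointsOn)
      (lose (∈-linesThrough⁺ P∈l) (∈-remove⁺ (∈-pointsOn⁺ X∈l) X≢P))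

  ∈-star⁻ : ∀ {P X} → X ∈ star P → Collinear P X × X ≢ P
  ∈-star⁻ {P} X∈ =
    let l , l∈ , X∈l∖P = find (∈-concatMap⁻ (remove P ∘ pointsOn) {xs = linesThrough P} X∈)
        X∈l , X≢P = ∈-remove⁻ (pointsOn l) X∈l∖P
    in (l , ∈-linesThrough⁻ l∈ , ∈-pointsOn⁻ X∈l) , X≢P

  length-star : ∀ P → length (star P) ≡ suc s * s
  length-star P = trans (length-concat (linesThrough P) ∈-linesThrough⁻) (cong (_* s) (point-deg P))
    where
    length-concat : ∀ ls → (∀ {l} → l ∈ ls → I P l ≡ true) →
                    length (concatMap (remove P ∘ pointsOn) ls) ≡ length ls * s
    length-concat [] _ = refl
    length-concat (l ∷ ls) ls∋P = trans (length-++ (remove P (pointsOn l)))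
      (cong₂ _+_ (length-remove-pointsOn (ls∋P (here refl))) (length-concat ls (ls∋P ∘ there)))

  -- Lines through P meet only in P, so the punctured lines through P are disjoint.
  star-unique : ∀ P → Unique (star P)
  star-unique P = unique-concat (linesThrough-unique P) ∈-linesThrough⁻
    where
    unique-concat : ∀ {ls} → Unique ls → (∀ {l} → l ∈ ls → I P l ≡ true) →
                    Unique (concatMap (remove P ∘ pointsOn) ls)
    unique-concat {[]} _ _ = []
    unique-concat {l ∷ ls} (l∉ls ∷ ls!) ls∋P =
      Unique.++⁺ (remove-unique (pointsOn-unique l)) (unique-concat ls! (ls∋P ∘ there)) disjoint
      where
      disjoint : ∀ {X} → ¬ (X ∈ remove P (pointsOn l) × X ∈ concatMap (remove P ∘ pointsOn) ls)
      disjoint {X} (X∈l∖P , X∈ls) =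
        let m , m∈ls , X∈m∖P = find (∈-concatMap⁻ (remove P ∘ pointsOn) {xs = ls} X∈ls)
            X∈l , X≢P = ∈-remove⁻ (pointsOn l) X∈l∖P
            X∈m , _ = ∈-remove⁻ (pointsOn m) X∈m∖P
        in All.lookup l∉ls m∈ls (partial X P l m X≢P (∈-pointsOn⁻ X∈l) (ls∋P (here refl))
                                                    (∈-pointsOn⁻ X∈m) (ls∋P (there m∈ls)))

  perp-sym : ∀ {P Q} → IsPerp P Q → IsPerp Q P
  perp-sym P⊥Q (l , Q∈l , P∈l) = P⊥Q (l , P∈l , Q∈l)

  perp⇒≢ : ∀ {P Q} → IsPerp P Q → Q ≢ P
  perp⇒≢ {P} P⊥Q refl = P⊥Q (collinear-refl P)

  perp⇒∉star : ∀ {P Q} → IsPerp P Q → Q ∉ star P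
  perp⇒∉star P⊥Q Q∈ = P⊥Q (proj₁ (∈-star⁻ Q∈))

  perp⇒off-line : ∀ {P Q l} → IsPerp P Q → I P l ≡ true → I Q l ≡ false
  perp⇒off-line {l = l} P⊥Q P∈l = ¬-not λ Q∈l → P⊥Q (l , P∈l , Q∈l)

  -- The count nAP s = 2 + |star P| leaves room for exactly one point besides P and star P.
  perp-exists : ∀ P → ∃ (IsPerp P)
  perp-exists P with any? (λ Q → ¬? (collinear? P Q))
  ... | yes ∃Q⊥P = ∃Q⊥P
  ... | no ∄Q⊥P = ⊥-elim (<⇒≱ (≤-reflexive (sym (nAP≡ s)))
    (subst₂ _≤_ (length-tabulate _) (cong suc (length-star P))
      (Unique-⊆⇒length≤ (Unique.allFin⁺ (nAP s)) all-near-P)))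
    where
    all-near-P : ∀ {Q} → Q ∈ allFin (nAP s) → Q ∈ P ∷ star P
    all-near-P {Q} _ with Q ≟ᶠ P
    ... | yes Q≡P = here Q≡P
    ... | no Q≢P  = there (∈-star⁺ (decidable-stable (collinear? P Q) λ P⊥Q → ∄Q⊥P (Q , P⊥Q)) Q≢P)

  perp-unique : ∀ {P Q₁ Q₂} → IsPerp P Q₁ → IsPerp P Q₂ → Q₁ ≡ Q₂
  perp-unique {P} {Q₁} {Q₂} P⊥Q₁ P⊥Q₂ = decidable-stable (Q₁ ≟ᶠ Q₂) λ Q₁≢Q₂ →
    <⇒≱ (≤-reflexive (cong suc (nAP≡ s)))
      (subst₂ _≤_ (cong (3 +_) (length-star P)) (length-tabulate _)
        (Unique-⊆⇒length≤ (distinct Q₁≢Q₂) (λ {X} _ → ∈-allFin X)))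
    where
    distinct : Q₁ ≢ Q₂ → Unique (Q₁ ∷ Q₂ ∷ P ∷ star P)
    distinct Q₁≢Q₂ =
      (Q₁≢Q₂ ∷ perp⇒≢ P⊥Q₁ ∷ ¬Any⇒All¬ _ (perp⇒∉star P⊥Q₁)) ∷
      (perp⇒≢ P⊥Q₂ ∷ ¬Any⇒All¬ _ (perp⇒∉star P⊥Q₂)) ∷
      All.tabulate (λ X∈ P≡X → proj₂ (∈-star⁻ X∈) (sym P≡X)) ∷
      star-unique P

  antipode : Fin (nAP s) → Fin (nAP s)
  antipode P = proj₁ (perp-exists P)

  antipode-perp : ∀ P → IsPerp P (antipode P)
  antipode-perp P = proj₂ (perp-exists P)

  perp⇒≡antipode : ∀ {P Q} → IsPerp P Q → Q ≡ antipode P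
  perp⇒≡antipode P⊥Q = perp-unique P⊥Q (antipode-perp _)

  perp⇒I≡I-antipode : ∀ {P Q l} → IsPerp P Q → I Q l ≡ I (antipode P) l
  perp⇒I≡I-antipode {l = l} P⊥Q = cong (λ X → I X l) (perp⇒≡antipode P⊥Q)

  antipode-involutive : ∀ P → antipode (antipode P) ≡ P
  antipode-involutive P = sym (perp⇒≡antipode (perp-sym (antipode-perp P)))

  ¬perp⇒collinear : ∀ {P Q} → ¬ IsPerp P Q → Collinear P Q
  ¬perp⇒collinear {P} {Q} = decidable-stable (collinear? P Q)

  antipode-injective : ∀ {P Q} → antipode P ≡ antipode Q → P ≡ Q
  antipode-injective {P} {Q} P⊥≡Q⊥ =
    trans (sym (antipode-involutive P)) (trans (cong antipode P⊥≡Q⊥) (antipode-involutive Q))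

  collinear⇒≢antipode : ∀ {P Q} → Collinear P Q → Q ≢ antipode P
  collinear⇒≢antipode {P} P~Q refl = antipode-perp P P~Q

  ≢⇒collinear-antipode : ∀ {P Q} → P ≢ Q → Collinear P (antipode Q)
  ≢⇒collinear-antipode P≢Q =
    ¬perp⇒collinear λ P⊥Q⊥ → P≢Q (sym (antipode-injective (perp⇒≡antipode P⊥Q⊥)))

module EmbeddedAntipodalPlane {c ℓ : Level} {q s : ℕ} (K : FiniteField c ℓ q)
                              (𝒜 : AntipodalPlane s) (E : Embedding K 𝒜) where
  open AntipodalPlane 𝒜
  open Embedding E
  open PG K using (Inc) renaming (Collinear to PGCollinear)
  open Coordinates K using (¬Inc⇒¬Collinear)
  open AntipodalPlaneProperties 𝒜
  open Removal (_≟ᶠ_ {nAP s})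

  GoodTriangle : Set (c ⊔ ℓ)
  GoodTriangle = ∃ λ A₁ → ∃ λ A₂ → ∃ λ A₃ →
    ¬ PGCollinear (φ A₁) (φ A₂) (φ A₃) ×
    ∃ λ l₁₂ → ∃ λ l₁₃ → ∃ λ l₂₃ →
      ((I A₁ l₁₂ ≡ true) × (I A₂ l₁₂ ≡ true)) ×
      ((I A₁ l₁₃ ≡ true) × (I A₃ l₁₃ ≡ true)) ×
      ((I A₂ l₂₃ ≡ true) × (I A₃ l₂₃ ≡ true)) ×
      (∀ Q → (IsPerp A₁ Q ⊎ IsPerp A₂ Q ⊎ IsPerp A₃ Q) →
         ¬ Inc (φ Q) (ψ l₁₂) × ¬ Inc (φ Q) (ψ l₁₃) × ¬ Inc (φ Q) (ψ l₂₃))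

  good-triangle : ∀ {A₁ A₂ A₃ l₁₂ l₁₃ l₂₃} → A₁ ≢ A₂ →
    I A₁ l₁₂ ≡ true → I A₂ l₁₂ ≡ true → I A₁ l₁₃ ≡ true → I A₃ l₁₃ ≡ true →
    I A₂ l₂₃ ≡ true → I A₃ l₂₃ ≡ true → I A₃ l₁₂ ≡ false →
    I (antipode A₁) l₂₃ ≡ false → I (antipode A₂) l₁₃ ≡ false → I (antipode A₃) l₁₂ ≡ false →
    GoodTriangle
  good-triangle {A₁} {A₂} {A₃} {l₁₂} {l₁₃} {l₂₃} A₁≢A₂ A₁∈l₁₂ A₂∈l₁₂ A₁∈l₁₃ A₃∈l₁₃ A₂∈l₂₃ A₃∈l₂₃
                A₃∉l₁₂ A₁⊥∉l₂₃ A₂⊥∉l₁₃ A₃⊥∉l₁₂ =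
    A₁ , A₂ , A₃ ,
    ¬Inc⇒¬Collinear (φ A₁) (φ A₂) (φ A₃) (ψ l₁₂) (A₁≢A₂ ∘ φ-inj A₁ A₂)
      (inc A₁ l₁₂ A₁∈l₁₂) (inc A₂ l₁₂ A₂∈l₁₂) (noninc A₃ l₁₂ A₃∉l₁₂) ,
    l₁₂ , l₁₃ , l₂₃ , (A₁∈l₁₂ , A₂∈l₁₂) , (A₁∈l₁₃ , A₃∈l₁₃) , (A₂∈l₂₃ , A₃∈l₂₃) , antipodes-off
    where
    off-side : ∀ {P Q l} → IsPerp P Q → I P l ≡ true → ¬ Inc (φ Q) (ψ l)
    off-side P⊥Q P∈l = noninc _ _ (perp⇒off-line P⊥Q P∈l)

    off-opposite : ∀ {P Q l} → IsPerp P Q → I (antipode P) l ≡ false → ¬ Inc (φ Q) (ψ l)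
    off-opposite P⊥Q P⊥∉l = noninc _ _ (trans (perp⇒I≡I-antipode P⊥Q) P⊥∉l)

    antipodes-off : ∀ Q → IsPerp A₁ Q ⊎ IsPerp A₂ Q ⊎ IsPerp A₃ Q →
                    ¬ Inc (φ Q) (ψ l₁₂) × ¬ Inc (φ Q) (ψ l₁₃) × ¬ Inc (φ Q) (ψ l₂₃)
    antipodes-off Q (inj₁ A₁⊥Q) =
      off-side A₁⊥Q A₁∈l₁₂ , off-side A₁⊥Q A₁∈l₁₃ , off-opposite A₁⊥Q A₁⊥∉l₂₃
    antipodes-off Q (inj₂ (inj₁ A₂⊥Q)) =
      off-side A₂⊥Q A₂∈l₁₂ , off-opposite A₂⊥Q A₂⊥∉l₁₃ , off-side A₂⊥Q A₂∈l₂₃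
    antipodes-off Q (inj₂ (inj₂ A₃⊥Q)) =
      off-opposite A₃⊥Q A₃⊥∉l₁₂ , off-side A₃⊥Q A₃∈l₁₃ , off-side A₃⊥Q A₃∈l₂₃

  module Covering {A₁ A₂ l₁₂ n m} (A₁≢A₂ : A₁ ≢ A₂)
                  (A₁∈l₁₂ : I A₁ l₁₂ ≡ true) (A₂∈l₁₂ : I A₂ l₁₂ ≡ true)
                  (A₂∈n : I A₂ n ≡ true) (A₁⊥∈n : I (antipode A₁) n ≡ true)
                  (A₁∈m : I A₁ m ≡ true) (A₂⊥∈m : I (antipode A₂) m ≡ true) where

    inner : List (Fin (nAP s))
    inner = remove A₂ (remove A₁ (pointsOn l₁₂))

    covered : List (Fin (nAP s))
    covered = inner ++ pointsOn n ++ pointsOn m ++ map antipode inner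

    length-inner : suc (length inner) ≤ s
    length-inner = ≤-trans (length-remove-< (∈-remove⁺ (∈-pointsOn⁺ A₂∈l₁₂) (A₁≢A₂ ∘ sym)))
                           (≤-reflexive (length-remove-pointsOn A₁∈l₁₂))

    length-covered : length covered ≡ length inner + (suc s + (suc s + length inner))
    length-covered = begin
      length covered
        ≡⟨ length-++ inner ⟩
      length inner + length (pointsOn n ++ pointsOn m ++ map antipode inner)
        ≡⟨ cong (length inner +_) (length-++ (pointsOn n)) ⟩
      length inner + (length (pointsOn n) + length (pointsOn m ++ map antipode inner))
        ≡⟨ cong (λ k → length inner + (length (pointsOn n) + k)) (length-++ (pointsOn m)) ⟩
      length inner + (length (pointsOn n) + (length (pointsOn m) + length (map antipode inner)))
        ≡⟨ cong₂ (λ a b → length inner + (a + b))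
                 (line-size n) (cong₂ _+_ (line-size m) (length-map antipode inner)) ⟩
      length inner + (suc s + (suc s + length inner)) ∎
      where open ≡.≡-Reasoning

    on-n : ∀ {X} → I X n ≡ true → X ∈ covered
    on-n X∈n = ∈-++⁺ʳ inner (∈-++⁺ˡ (∈-pointsOn⁺ X∈n))

    on-m : ∀ {X} → I X m ≡ true → X ∈ covered
    on-m X∈m = ∈-++⁺ʳ inner (∈-++⁺ʳ (pointsOn n) (∈-++⁺ˡ (∈-pointsOn⁺ X∈m)))

    inner⁺ : ∀ {X} → I X l₁₂ ≡ true → X ≢ A₁ → X ≢ A₂ → X ∈ inner
    inner⁺ X∈l₁₂ X≢A₁ X≢A₂ = ∈-remove⁺ (∈-remove⁺ (∈-pointsOn⁺ X∈l₁₂) X≢A₁) X≢A₂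

    antipode-in-inner : ∀ {X} → antipode X ∈ inner → X ∈ covered
    antipode-in-inner {X} X⊥∈inner = subst (_∈ covered) (antipode-involutive X)
      (∈-++⁺ʳ inner (∈-++⁺ʳ (pointsOn n) (∈-++⁺ʳ (pointsOn m) (∈-map⁺ antipode X⊥∈inner))))

    cover-on-l₁₂ : ∀ {X} → I X l₁₂ ≡ true → X ∈ covered
    cover-on-l₁₂ {X} X∈l₁₂ with X ≟ᶠ A₁ | X ≟ᶠ A₂
    ... | yes refl | _        = on-m A₁∈m
    ... | no _     | yes refl = on-n A₂∈n
    ... | no X≢A₁  | no X≢A₂  = ∈-++⁺ˡ (inner⁺ X∈l₁₂ X≢A₁ X≢A₂)

    cover-off-l₁₂ : ∀ {X} → I X l₁₂ ≡ false → GoodTriangle ⊎ X ∈ covered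
    cover-off-l₁₂ {X} X∉l₁₂ with collinear? A₁ X | collinear? A₂ X
    ... | no A₁⊥X | _       = inj₂ (on-n (trans (perp⇒I≡I-antipode A₁⊥X) A₁⊥∈n))
    ... | yes _   | no A₂⊥X = inj₂ (on-m (trans (perp⇒I≡I-antipode A₂⊥X) A₂⊥∈m))
    ... | yes (l₁₃ , A₁∈l₁₃ , X∈l₁₃) | yes (l₂₃ , A₂∈l₂₃ , X∈l₂₃)
      with I (antipode A₁) l₂₃ in A₁⊥∈?l₂₃
         | I (antipode A₂) l₁₃ in A₂⊥∈?l₁₃
         | I (antipode X) l₁₂ in X⊥∈?l₁₂
    ... | true | _ | _ = inj₂ (on-n (subst (λ l → I X l ≡ true)
          (partial A₂ (antipode A₁) l₂₃ n A₂≢A₁⊥ A₂∈l₂₃ A₁⊥∈?l₂₃ A₂∈n A₁⊥∈n) X∈l₂₃))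
      where
      A₂≢A₁⊥ : A₂ ≢ antipode A₁
      A₂≢A₁⊥ = collinear⇒≢antipode (l₁₂ , A₁∈l₁₂ , A₂∈l₁₂)
    ... | _ | true | _ = inj₂ (on-m (subst (λ l → I X l ≡ true)
          (partial A₁ (antipode A₂) l₁₃ m A₁≢A₂⊥ A₁∈l₁₃ A₂⊥∈?l₁₃ A₁∈m A₂⊥∈m) X∈l₁₃))
      where
      A₁≢A₂⊥ : A₁ ≢ antipode A₂
      A₁≢A₂⊥ = collinear⇒≢antipode (l₁₂ , A₂∈l₁₂ , A₁∈l₁₂)
    ... | _ | _ | true = inj₂ (antipode-in-inner (inner⁺ X⊥∈?l₁₂
          (collinear⇒≢antipode (l₁₃ , X∈l₁₃ , A₁∈l₁₃) ∘ sym)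
          (collinear⇒≢antipode (l₂₃ , X∈l₂₃ , A₂∈l₂₃) ∘ sym)))
    ... | false | false | false = inj₁ (good-triangle A₁≢A₂ A₁∈l₁₂ A₂∈l₁₂ A₁∈l₁₃ X∈l₁₃ A₂∈l₂₃ X∈l₂₃
                                       X∉l₁₂ A₁⊥∈?l₂₃ A₂⊥∈?l₁₃ X⊥∈?l₁₂)

    cover : ∀ X → GoodTriangle ⊎ X ∈ covered
    cover X with I X l₁₂ in X∈l₁₂
    ... | true  = inj₂ (cover-on-l₁₂ X∈l₁₂)
    ... | false = cover-off-l₁₂ X∈l₁₂

    good-triangle-exists : 3 ≤ s → GoodTriangle
    good-triangle-exists 3≤s = [ id , too-many-points ]′ (∀⊎⇒⊎∀ cover)
      where
      too-many-points : (∀ X → X ∈ covered) → GoodTriangle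
      too-many-points all-covered = ⊥-elim (<⇒≱ (r+[1+s+[1+s+r]]<nAP 3≤s length-inner)
        (subst₂ _≤_ (length-tabulate id) length-covered
          (Unique-⊆⇒length≤ (Unique.allFin⁺ (nAP s)) λ {X} _ → all-covered X)))

  good-triangle-exists : 3 ≤ s → GoodTriangle
  good-triangle-exists 3≤s =
    let A₁ = Fin.cast (sym (nAP≡ s)) Fin.zero
        l₁₂ , l₁₂∋A₁ = 0<length⇒∃∈ (subst (0 <_) (sym (point-deg A₁)) z<s)
        A₁∈l₁₂ = ∈-linesThrough⁻ l₁₂∋A₁
        A₂ , A₂∈l₁₂∖A₁ = 0<length⇒∃∈ (subst (0 <_) (sym (length-remove-pointsOn A₁∈l₁₂))
                                                 (≤-trans (s≤s z≤n) 3≤s))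
        A₂∈l₁₂ , A₂≢A₁ = ∈-remove⁻ (pointsOn l₁₂) A₂∈l₁₂∖A₁
        n , A₂∈n , A₁⊥∈n = ≢⇒collinear-antipode A₂≢A₁
        m , A₁∈m , A₂⊥∈m = ≢⇒collinear-antipode (A₂≢A₁ ∘ sym)
    in Covering.good-triangle-exists (A₂≢A₁ ∘ sym) A₁∈l₁₂ (∈-pointsOn⁻ A₂∈l₁₂)
                                     A₂∈n A₁⊥∈n A₁∈m A₂⊥∈m 3≤s

mainTheorem12 : ∀ {c ℓ : Level} {q s : ℕ} → s ≥ 3 →
  (K : FiniteField c ℓ q) (A : AntipodalPlane s) (E : Embedding K A) →
  let open AntipodalPlane A
      open Embedding E
      open PG K using (Inc) renaming (Collinear to PGCollinear)
  in ∃ λ A₁ → ∃ λ A₂ → ∃ λ A₃ →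
     ¬ PGCollinear (φ A₁) (φ A₂) (φ A₃) ×
     ∃ λ l₁₂ → ∃ λ l₁₃ → ∃ λ l₂₃ →
       ((I A₁ l₁₂ ≡ true) × (I A₂ l₁₂ ≡ true)) ×
       ((I A₁ l₁₃ ≡ true) × (I A₃ l₁₃ ≡ true)) ×
       ((I A₂ l₂₃ ≡ true) × (I A₃ l₂₃ ≡ true)) ×
       (∀ Q → (IsPerp A₁ Q ⊎ IsPerp A₂ Q ⊎ IsPerp A₃ Q) →
          ¬ Inc (φ Q) (ψ l₁₂) × ¬ Inc (φ Q) (ψ l₁₃) × ¬ Inc (φ Q) (ψ l₂₃))
mainTheorem12 s≥3 K A E = EmbeddedAntipodalPlane.good-triangle-exists K A E s≥3
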